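{- For every integer $n\ge 1$, the hexagonal stacked prism $Y_{6,n}$ is odd prime.
   Context: All graphs are finite and simple. An odd prime labeling of a graph $G$ with $N$ vertices is a bijection $\ell:V(G)\to\{1,3,\dots,2N-1\}$ such that $\gcd(\ell(u),\ell(v))=1$ for every edge $uv$; $G$ is odd prime if it has one. For $k\ge 3$, $n\ge 1$, the stacked prism $Y_{k,n}$ is the Cartesian product $C_k\,\square\,P_n$ of the cycle on $k$ vertices with the path on $n$ vertices: its vertices are $v_{i,j}$ ($1\le i\le n$, $1\le j\le k$), with edges $v_{i,j}v_{i,j+1}$ ($1\le j\le k-1$) and $v_{i,k}v_{i,1}$ for each $i$, and $v_{i,j}v_{i+1,j}$ for $1\le i\le n-1$, $1\le j\le k$. -}

module Defs where

open import Data.Nat using (ℕ; zero; suc; _+_; _*_)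
open import Data.Nat.GCD using (gcd)
open import Data.Fin using (Fin; toℕ; inject₁) renaming (suc to fsuc; zero to fzero)
open import Data.Product using (_×_; _,_; proj₁; proj₂)
open import Data.Sum using (_⊎_)
open import Relation.Binary.PropositionalEquality using (_≡_)
open import Function.Bundles using (_⤖_; Bijection)

odd : ℕ → ℕ
odd i = 2 * i + 1

-- An odd prime labeling of a graph with vertex type V and N vertices:
-- a bijection ℓ : V → {1,3,…,2N-1}, encoded as a bijection idx : V ⤖ Fin N
-- followed by i ↦ 2i+1, such that adjacent vertices get coprime labels.
record OddPrimeLabeling (V : Set) (N : ℕ) (Adj : V → V → Set) : Set where
  field
    idx     : V ⤖ Fin N
  label : V → ℕ
  label v = odd (toℕ (Bijection.to idx v))
  field
    coprime : ∀ u v → Adj u v → gcd (label u) (label v) ≡ 1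

CycAdj : (k : ℕ) → Fin k → Fin k → Set
CycAdj k j j' = Step j j' ⊎ Step j' j
  where
  Step : Fin k → Fin k → Set
  Step a b = (toℕ b ≡ suc (toℕ a)) ⊎ ((suc (toℕ a) ≡ k) × (toℕ b ≡ 0))

PathAdj : (n : ℕ) → Fin n → Fin n → Set
PathAdj n i i' = (toℕ i' ≡ suc (toℕ i)) ⊎ (toℕ i ≡ suc (toℕ i'))

BoxAdj : {A B : Set} → (A → A → Set) → (B → B → Set) → A × B → A × B → Set
BoxAdj RA RB (a , b) (a' , b') = (a ≡ a' × RB b b') ⊎ (RA a a' × b ≡ b')

-- The stacked prism Y_{k,n} = C_k □ P_n: vertex v_{i,j} is (i , j) with
-- i : Fin n (path/layer index) and j : Fin k (cycle index); n * k vertices.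
PrismAdj : (k n : ℕ) → Fin n × Fin k → Fin n × Fin k → Set
PrismAdj k n = BoxAdj (PathAdj n) (CycAdj k)

PrismOddPrime : (k n : ℕ) → Set
PrismOddPrime k n = OddPrimeLabeling (Fin n × Fin k) (n * k) (PrismAdj k n)

{-# OPTIONS --safe #-}
module Submission where

-- Give the vertex in cycle position j of layer m the label 12m + o_j, where the
-- offsets o run through (1,3,7,11,9,5) on even layers and (1,7,3,11,5,9) on odd
-- layers; every odd number below 12n is used once.  Adjacent labels a < b then
-- differ by d ∈ {2,4,6,8,12,16}, so gcd(a,b) = gcd(a,d), and this is 1 because
-- every label is odd and the gaps divisible by 3 only start at labels ≡ ±1 (mod 6).
-- As 12m + x ≡ x modulo every prime factor of d, the edge conditions become a
-- finite check on the offsets.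

open import Defs
open import Data.Bool using (Bool; true; false; not)
open import Data.Fin using (Fin; toℕ; combine; remQuot)
open import Data.Fin.Patterns using (0F; 1F; 2F; 3F; 4F; 5F)
open import Data.Fin.Permutation using (Permutation′; permutation; _⟨$⟩ʳ_; _⟨$⟩ˡ_; inverseˡ; inverseʳ)
open import Data.Fin.Properties using (toℕ-combine; remQuot-combine; combine-remQuot; all?)
open import Data.Nat using (ℕ; _≥_; suc; _+_; _*_; _^_; _∸_; _≤_; _≤?_; _≟_)
open import Data.Nat.Coprimality as Coprime using (Coprime; coprime?; coprime-divisor; coprime⇒gcd≡1)
open import Data.Nat.Divisibility using (_∣_; _∣?_; ∣-refl; ∣-trans; ∣m+n∣m⇒∣n; ∣m⇒∣m*n; ∣1⇒≡1)
open import Data.Nat.Properties using (m+[n∸m]≡n; +-assoc)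
open import Data.Nat.Tactic.RingSolver using (solve-∀)
open import Data.Product using (_×_; _,_; uncurry)
open import Data.Sum using (_⊎_; inj₁; inj₂)
open import Function using (_∘_)
open import Function.Bundles using (_⤖_; Bijection; mk↔ₛ′)
open import Function.Properties.Inverse using (↔⇒⤖)
open import Relation.Binary.PropositionalEquality using (_≡_; refl; cong; subst; subst₂; sym; trans)
open import Relation.Nullary.Decidable using (Dec; from-yes; _×-dec_; _⊎-dec_; _→-dec_)

coprime-∣ˡ : ∀ {a b c} → c ∣ a → Coprime a b → Coprime c b
coprime-∣ˡ c∣a coprime (d∣c , d∣b) = coprime (∣-trans d∣c c∣a , d∣b)

coprime-* : ∀ {a b c} → Coprime a b → Coprime a c → Coprime a (b * c)
coprime-* a⊥b a⊥c (d∣a , d∣bc) =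
  a⊥c (d∣a , coprime-divisor (coprime-∣ˡ d∣a a⊥b) d∣bc)

coprime-^ : ∀ {a b} j → Coprime a b → Coprime a (b ^ j)
coprime-^ 0       _   (_ , d∣1) = ∣1⇒≡1 d∣1
coprime-^ (suc j) a⊥b = coprime-* a⊥b (coprime-^ j a⊥b)

coprime-progression : ∀ {x d} k j m → Coprime x d → d ∣ k ^ j → Coprime (k * m + x) d
coprime-progression {x} {d} k j m x⊥d d∣kʲ {e} (e∣km+x , e∣d) =
  coprime-^ j e⊥k (∣-refl , ∣-trans e∣d d∣kʲ)
  where
  e⊥k : Coprime e k
  e⊥k (f∣e , f∣k) =
    x⊥d (∣m+n∣m⇒∣n (∣-trans f∣e e∣km+x) (∣m⇒∣m*n m f∣k) , ∣-trans f∣e e∣d)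

-- d ∣ k ^ 2 stands in for "every prime factor of the gap d divides k"; the square
-- suffices for the gaps of the hexagonal labelling.
Apart : ℕ → ℕ → ℕ → Set
Apart k x y = x ≤ y × Coprime x (y ∸ x) × (y ∸ x) ∣ k ^ 2

apart? : ∀ k x y → Dec (Apart k x y)
apart? k x y = x ≤? y ×-dec coprime? x (y ∸ x) ×-dec (y ∸ x) ∣? k ^ 2

apart⇒coprime : ∀ k {x y} m → Apart k x y → Coprime (k * m + x) (k * m + y)
apart⇒coprime k {x} {y} m (x≤y , x⊥d , d∣k²) =
  subst (Coprime (k * m + x)) shift
    (Coprime.sym (Coprime.coprime-+ (Coprime.sym (coprime-progression k 2 m x⊥d d∣k²))))
  where
  shift : k * m + x + (y ∸ x) ≡ k * m + y
  shift = trans (+-assoc (k * m) x (y ∸ x)) (cong (k * m +_) (m+[n∸m]≡n x≤y))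

apart⇒coprime-suc : ∀ k {x y} m → Apart k x (k + y) → Coprime (k * m + x) (k * suc m + y)
apart⇒coprime-suc k {x} {y} m apart =
  subst (Coprime (k * m + x)) (next-layer k m y) (apart⇒coprime k m apart)
  where
  next-layer : ∀ k m y → k * m + (k + y) ≡ k * suc m + y
  next-layer = solve-∀

Separated : ℕ → ℕ → ℕ → Set
Separated k x y = Apart k x y ⊎ Apart k y x

separated? : ∀ k x y → Dec (Separated k x y)
separated? k x y = apart? k x y ⊎-dec apart? k y x

separated⇒coprime : ∀ k {x y} m → Separated k x y → Coprime (k * m + x) (k * m + y)
separated⇒coprime k m (inj₁ apart) = apart⇒coprime k m apart
separated⇒coprime k m (inj₂ apart) = Coprime.sym (apart⇒coprime k m apart)

module _ {n k : ℕ} (π : Fin n → Permutation′ k) where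

  layered : (Fin n × Fin k) ⤖ Fin (n * k)
  layered = ↔⇒⤖ (mk↔ₛ′ to from to∘from from∘to)
    where
    to : Fin n × Fin k → Fin (n * k)
    to (i , j) = combine i (π i ⟨$⟩ʳ j)

    unpermute : Fin n × Fin k → Fin n × Fin k
    unpermute (i , s) = i , π i ⟨$⟩ˡ s

    from : Fin (n * k) → Fin n × Fin k
    from = unpermute ∘ remQuot k

    to∘unpermute : ∀ p → to (unpermute p) ≡ uncurry combine p
    to∘unpermute (i , s) = cong (combine i) (inverseʳ (π i))

    to∘from : ∀ c → to (from c) ≡ c
    to∘from c = trans (to∘unpermute (remQuot k c)) (combine-remQuot {n} k c)

    from∘to : ∀ p → from (to p) ≡ p
    from∘to (i , j) =
      trans (cong unpermute (remQuot-combine i (π i ⟨$⟩ʳ j))) (cong (i ,_) (inverseˡ (π i)))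

  toℕ-layered : ∀ i j → toℕ (Bijection.to layered (i , j)) ≡ k * toℕ i + toℕ (π i ⟨$⟩ʳ j)
  toℕ-layered i j = toℕ-combine i (π i ⟨$⟩ʳ j)

parity : ℕ → Bool
parity 0       = false
parity (suc m) = not (parity m)

-- Cycle position ↦ rank of its label within the layer; the offset is 2·rank + 1.
hexLayer : Bool → Permutation′ 6
hexLayer false = permutation
  (λ { 0F → 0F ; 1F → 1F ; 2F → 3F ; 3F → 5F ; 4F → 4F ; 5F → 2F })
  (λ { 0F → 0F ; 1F → 1F ; 2F → 5F ; 3F → 2F ; 4F → 4F ; 5F → 3F })
  (λ { 0F → refl ; 1F → refl ; 2F → refl ; 3F → refl ; 4F → refl ; 5F → refl })
  (λ { 0F → refl ; 1F → refl ; 2F → refl ; 3F → refl ; 4F → refl ; 5F → refl })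
hexLayer true = permutation
  (λ { 0F → 0F ; 1F → 3F ; 2F → 1F ; 3F → 5F ; 4F → 2F ; 5F → 4F })
  (λ { 0F → 0F ; 1F → 2F ; 2F → 4F ; 3F → 1F ; 4F → 5F ; 5F → 3F })
  (λ { 0F → refl ; 1F → refl ; 2F → refl ; 3F → refl ; 4F → refl ; 5F → refl })
  (λ { 0F → refl ; 1F → refl ; 2F → refl ; 3F → refl ; 4F → refl ; 5F → refl })

hexPrismIndex : ∀ n → (Fin n × Fin 6) ⤖ Fin (n * 6)
hexPrismIndex n = layered (hexLayer ∘ parity ∘ toℕ)

hexOffset : Bool → Fin 6 → ℕ
hexOffset b j = odd (toℕ (hexLayer b ⟨$⟩ʳ j))

odd-hexPrismIndex : ∀ {n} (i : Fin n) j →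
  odd (toℕ (Bijection.to (hexPrismIndex n) (i , j))) ≡ 12 * toℕ i + hexOffset (parity (toℕ i)) j
odd-hexPrismIndex i j =
  trans (cong odd (toℕ-layered (hexLayer ∘ parity ∘ toℕ) i j)) (odd-6*+ (toℕ i) _)
  where
  odd-6*+ : ∀ a s → 2 * (6 * a + s) + 1 ≡ 12 * a + (2 * s + 1)
  odd-6*+ = solve-∀

cycAdj? : ∀ k j j' → Dec (CycAdj k j j')
cycAdj? k j j' = step? j j' ⊎-dec step? j' j
  where
  step? : ∀ a b → Dec ((toℕ b ≡ suc (toℕ a)) ⊎ ((suc (toℕ a) ≡ k) × (toℕ b ≡ 0)))
  step? a b = toℕ b ≟ suc (toℕ a) ⊎-dec (suc (toℕ a) ≟ k ×-dec toℕ b ≟ 0)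

hexCycle-separated : ∀ b j j' → CycAdj 6 j j' → Separated 12 (hexOffset b j) (hexOffset b j')
hexCycle-separated false = from-yes (all? λ j → all? λ j' →
  cycAdj? 6 j j' →-dec separated? 12 (hexOffset false j) (hexOffset false j'))
hexCycle-separated true = from-yes (all? λ j → all? λ j' →
  cycAdj? 6 j j' →-dec separated? 12 (hexOffset true j) (hexOffset true j'))

hexRung-apart : ∀ b j → Apart 12 (hexOffset b j) (12 + hexOffset (not b) j)
hexRung-apart false = from-yes (all? λ j → apart? 12 (hexOffset false j) (12 + hexOffset true j))
hexRung-apart true = from-yes (all? λ j → apart? 12 (hexOffset true j) (12 + hexOffset false j))

hexOffsets-coprime : ∀ {n} i j i' j' → PrismAdj 6 n (i , j) (i' , j') →
  Coprime (12 * toℕ i + hexOffset (parity (toℕ i)) j)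
          (12 * toℕ i' + hexOffset (parity (toℕ i')) j')
hexOffsets-coprime i j .i j' (inj₁ (refl , j~j')) =
  separated⇒coprime 12 (toℕ i) (hexCycle-separated (parity (toℕ i)) j j' j~j')
hexOffsets-coprime i j i' .j (inj₂ (inj₁ i'≡1+i , refl)) rewrite i'≡1+i =
  apart⇒coprime-suc 12 (toℕ i) (hexRung-apart (parity (toℕ i)) j)
hexOffsets-coprime i j i' .j (inj₂ (inj₂ i≡1+i' , refl)) rewrite i≡1+i' =
  Coprime.sym (apart⇒coprime-suc 12 (toℕ i') (hexRung-apart (parity (toℕ i')) j))

hexPrism-coprime : ∀ n u v → PrismAdj 6 n u v →
  Coprime (odd (toℕ (Bijection.to (hexPrismIndex n) u)))
          (odd (toℕ (Bijection.to (hexPrismIndex n) v)))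
hexPrism-coprime n (i , j) (i' , j') adj =
  subst₂ Coprime (sym (odd-hexPrismIndex i j)) (sym (odd-hexPrismIndex i' j'))
    (hexOffsets-coprime i j i' j' adj)

mainTheorem8 : (n : ℕ) → n ≥ 1 → PrismOddPrime 6 n
mainTheorem8 n _ = record
  { idx     = hexPrismIndex n
  ; coprime = λ u v adj → coprime⇒gcd≡1 (hexPrism-coprime n u v adj)
  }
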